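{- There is $\eta_0>0$ such that for every $\eta\in(0,\eta_0]$ there is $\nu_0>0$ such that for every $\nu\in(0,\nu_0]$ there is $\beta_0>0$ such that for every $\beta\in(0,\beta_0]$ there is $\alpha_0>0$ such that for every $\alpha\in(0,\alpha_0]$ there is $\mu_0>0$ such that for every $\mu\in(0,\mu_0]$ there is $n_0$ such that for all $n\geq n_0$ the following holds. Let $\hat G$ be an $(\alpha,\eta,\nu)$-superextremal biclique on $n$ vertices with partition $V(\hat G)=A\uplus B$. Let $M$ be a matching in $\hat G[B]$ with $|E(M)|\leq\alpha n$ and set $Z=E(M)$. Suppose (D1) $\hat G[A]$ has no edges and the edge set of $\hat G[B]$ is exactly $E(M)$, and (D2) $\max\{d_{\hat G}(a,B),d_{\hat G}(b,A)\}\geq(1/2-\eta)n$ for all $a\in A$, $b\in B$ with $ab\in E(\hat G)$. Then for every directed Hamilton cycle $\vec H$ of $\hat G$ and every edge $e\in E(H)\setminus Z$, there are at least $\beta n^2$ pairs $(e',i)$ with $e'\in E(\hat G)\setminus E(H)$ (taken with an ordering of its endpoints) and $i\in\{1,2\}$ such that the switching $s_i(\vec H;e,e')$ is admissible.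
   Context: For $v\in V(F)$, $S\subseteq V(F)$, $d_F(v,S)$ is the number of neighbours of $v$ in $S$. A graph $F$ on $n$ vertices is an $(\alpha,\varepsilon,\nu)$-superextremal biclique with partition $V(F)=A\uplus B$ if: (B1) $0\leq|B|-|A|\leq\alpha n$; (B2) $d_F(a,B)\geq(1/2-\varepsilon)n$ for all but at most $\alpha n$ vertices $a\in A$; (B3) $d_F(a,B)\geq\nu n$ for all $a\in A$; (B4) $d_F(b,A)\geq(1/2-\varepsilon)n$ for all but at most $\alpha n$ vertices $b\in B$; (B5) $d_F(b,A)\geq(1/4-\varepsilon)n$ for all $b\in B$; (B6) unless $|A|=\lfloor n/2\rfloor$, $d_F(b,B)\leq2\nu n$ for all $b\in B$. A directed Hamilton cycle $\vec H$ of a graph $F$ is a Hamilton cycle with edges oriented so every vertex has out-degree one; $H$ is the underlying cycle and $\pi$ its successor function ($(x,\pi(x))\in E(\vec H)$). For $e=x\pi(x)\in E(H)$ and $e'=x'y'\notin E(H)$ with $x$ on the directed path from $y'$ to $x'$ in $\vec H$, $s_1(\vec H;e,e')$, $s_2(\vec H;e,e')$ are the directed cycles containing $(x',y')$ with underlying cycles $H_1=(H-\{e,x'\pi(x'),\pi^{ -1}(y')y'\})+\{e',x\pi(x'),\pi^{ -1}(y')\pi(x)\}$ and $H_2=(H-\{e,x'\pi(x'),\pi^{ -1}(y')y'\})+\{e',x\pi^{ -1}(y'),\pi(x)\pi(x')\}$. The switching $s_i(\vec H;e,e')$ is admissible if $H_i\subseteq F$.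
   Formalization: The parameters η, ν, β, α and μ, together with the thresholds η₀, ν₀, β₀, α₀ and μ₀, are taken in the rationals. -}

module Defs where

open import Data.Nat as ℕ using (ℕ; zero; suc; _<_; _≤_; _/_)
open import Data.Integer using (+_)
open import Data.Rational as ℚ using (ℚ; ½)
open import Data.Fin using (Fin; zero; suc; toℕ)
open import Data.Bool using (Bool; true; false; T; not; _∧_)
open import Data.Product using (Σ; ∃; ∃-syntax; _×_; _,_)
open import Data.Sum using (_⊎_)
open import Data.List using (List; length; map; allFin)
open import Data.Nat.ListAction using (sum)
open import Data.List.Relation.Unary.All using (All)
open import Data.List.Relation.Unary.Unique.Propositional using (Unique)
open import Function using (Injective)
open import Relation.Binary.PropositionalEquality using (_≡_; _≢_)
open import Relation.Nullary using (¬_)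

⟦_⟧ : ℕ → ℚ
⟦ n ⟧ = + n ℚ./ 1

¼ : ℚ
¼ = + 1 ℚ./ 4

record Graph (n : ℕ) : Set where
  field
    adj   : Fin n → Fin n → Bool
    sym   : ∀ u v → adj u v ≡ adj v u
    irrefl : ∀ v → adj v v ≡ false
open Graph public

E : ∀ {n} → Graph n → Fin n → Fin n → Set
E G u v = T (adj G u v)

count : ∀ {n} → (Fin n → Bool) → ℕ
count {zero}  P = 0
count {suc n} P with P zero
... | true  = suc (count {n} (λ i → P (suc i)))
... | false = count {n} (λ i → P (suc i))

deg : ∀ {n} → Graph n → Fin n → (Fin n → Bool) → ℕ
deg G v S = count (λ w → S w ∧ adj G v w)

AllButAtMost : ∀ {n} → ℚ → (Fin n → Bool) → (Fin n → Set) → Set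
AllButAtMost {n} k S P =
  Σ (Fin n → Bool) λ X → (⟦ count X ⟧ ℚ.≤ k) ×
    (∀ v → T (S v) → ¬ T (X v) → P v)

InB : ∀ {n} → (Fin n → Bool) → Fin n → Bool
InB inA v = not (inA v)

record Superextremal {n : ℕ} (α ε ν : ℚ) (F : Graph n)
                     (inA : Fin n → Bool) : Set where
  private
    A = inA
    B = InB inA
    nq = ⟦ n ⟧
  field
    B1a : count A ≤ count B
    B1b : ⟦ count B ℕ.∸ count A ⟧ ℚ.≤ α ℚ.* nq
    B2  : AllButAtMost (α ℚ.* nq) A
            (λ a → (½ ℚ.- ε) ℚ.* nq ℚ.≤ ⟦ deg F a B ⟧)
    B3  : ∀ a → T (A a) → ν ℚ.* nq ℚ.≤ ⟦ deg F a B ⟧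
    B4  : AllButAtMost (α ℚ.* nq) B
            (λ b → (½ ℚ.- ε) ℚ.* nq ℚ.≤ ⟦ deg F b A ⟧)
    B5  : ∀ b → T (B b) → (¼ ℚ.- ε) ℚ.* nq ℚ.≤ ⟦ deg F b A ⟧
    B6  : count A ≢ n / 2 →
            ∀ b → T (B b) → ⟦ deg F b B ⟧ ℚ.≤ (⟦ 2 ⟧ ℚ.* ν) ℚ.* nq

record MatchingIn {n : ℕ} (F : Graph n) (S : Fin n → Bool)
                  (M : Fin n → Fin n → Bool) : Set where
  field
    M-sym  : ∀ u v → M u v ≡ M v u
    M-sub  : ∀ u v → T (M u v) → T (adj F u v) × T (S u) × T (S v)
    M-uniq : ∀ u v w → T (M u v) → T (M u w) → v ≡ w

edgeCount : ∀ {n} → (Fin n → Fin n → Bool) → ℕ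
edgeCount {n} M =
  sum (map (λ u → count (λ v → (toℕ u ℕ.<ᵇ toℕ v) ∧ M u v)) (allFin n))

iter : ∀ {n} → (Fin n → Fin n) → ℕ → Fin n → Fin n
iter π zero    x = x
iter π (suc k) x = π (iter π k x)

record DirHamCycle {n : ℕ} (F : Graph n) (π : Fin n → Fin n) : Set where
  field
    π-inj   : Injective _≡_ _≡_ π
    π-edge  : ∀ x → E F x (π x)
    π-trans : ∀ x y → ∃[ k ] iter π k x ≡ y

EdgeH : ∀ {n} → (Fin n → Fin n) → Fin n → Fin n → Set
EdgeH π u v = (v ≡ π u) ⊎ (u ≡ π v)

SameEdge : ∀ {n} → Fin n → Fin n → Fin n → Fin n → Set
SameEdge u v a b = (u ≡ a × v ≡ b) ⊎ (u ≡ b × v ≡ a)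

OnPath : ∀ {n} → (Fin n → Fin n) → Fin n → Fin n → Fin n → Set
OnPath {n} π x y' x' =
  Σ ℕ λ j → Σ ℕ λ k → j < n × k ≤ j × iter π j y' ≡ x' × iter π k y' ≡ x

data SwitchType : Set where
  s₁ s₂ : SwitchType

-- edge set of H_i for the switching s_i(H; x π(x), x'y'),
-- where p = π⁻¹(y')
EdgeHi : ∀ {n} → (Fin n → Fin n) → SwitchType →
         (x x' y' p : Fin n) → Fin n → Fin n → Set
EdgeHi π i x x' y' p u v =
  (EdgeH π u v × ¬ SameEdge u v x (π x) × ¬ SameEdge u v x' (π x')
     × ¬ SameEdge u v p y')
  ⊎ SameEdge u v x' y' ⊎ added i
  where
  added : SwitchType → Set
  added s₁ = SameEdge u v x (π x') ⊎ SameEdge u v p (π x)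
  added s₂ = SameEdge u v x p ⊎ SameEdge u v (π x) (π x')

Admissible : ∀ {n} → Graph n → (Fin n → Fin n) → SwitchType →
             (x x' y' : Fin n) → Set
Admissible F π i x x' y' =
  ∀ p → π p ≡ y' → ∀ u v → EdgeHi π i x x' y' p u v → E F u v

-- (x',y',i) is a pair (e',i) as counted in the theorem, for e = x π(x)
GoodSwitch : ∀ {n} → Graph n → (Fin n → Fin n) → Fin n →
             Fin n × Fin n × SwitchType → Set
GoodSwitch F π x (x' , y' , i) =
  E F x' y' × ¬ EdgeH π x' y' × OnPath π x y' x' × Admissible F π i x x' y'

module Submission where

-- Let e = xπ(x).  By (D1) the set A is independent, so one endpoint a of e lies
-- in A, and since e ∉ M the other endpoint b lies in B.  Number the cycle
-- c₀ = π(x), …, c_{n-1} = x.  A pivot is a B-neighbour p of a whose cycle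
-- neighbours π⁻¹(p), π(p) are typical A-vertices (degree ≥ (1/2-η)n into B);
-- a partner of p is an A-neighbour q of b with π⁻¹(p) ~ π(q) and π(p) ~ π⁻¹(q).
-- For such p, q (away from e) the chord joining π⁻¹ of the earlier of p, q to π
-- of the later one, together with ap and bq, is an admissible switching, and
-- (p, q) can be read back from it.  Degree counting gives ≥ d(a,B)/2 ≥ νn/2
-- pivots with ≥ n/5 partners each, hence ≥ νn²/10 switchings.

open import Defs hiding (sym)
open import Data.Fin using (Fin)
import Data.Nat as ℕ

module Counting where

  open import Data.Nat using (zero; suc; _+_; _≤_; z≤n; s≤s)
  open import Data.Nat.Properties hiding (_≟_; suc-injective)
  open import Data.Fin using (Fin; zero; suc)
  open import Data.Fin.Properties using (_≟_; suc-injective)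
  open import Data.Bool using (Bool; true; false; T; not; _∧_; _∨_)
  open import Data.Bool.Properties using (T-∧)
  open import Data.Product using (_,_)
  open import Data.Empty using (⊥-elim)
  open import Data.Unit using (tt)
  open import Data.List using (List; []; _∷_; length; map)
  open import Data.List.Properties using (length-map)
  open import Data.List.Relation.Unary.All as All using (All; []; _∷_)
  import Data.List.Relation.Unary.All.Properties as AllP
  open import Data.List.Relation.Unary.Unique.Propositional using (Unique)
  open import Data.List.Relation.Unary.AllPairs using ([]; _∷_)
  import Data.List.Relation.Unary.Unique.Propositional.Properties as UniqueP
  open import Data.List.Membership.Propositional using (_∈_)
  open import Data.List.Membership.Propositional.Properties using (∈-map⁻)
  open import Function.Bundles using (Equivalence)
  open import Relation.Binary.PropositionalEquality
  open import Relation.Nullary using (¬_; yes; no)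
  open import Relation.Nullary.Decidable using (⌊_⌋)

  open Equivalence using (from)

  T-∧-intro : ∀ {b c} → T b → T c → T (b ∧ c)
  T-∧-intro p q = from T-∧ (p , q)

  T-not-intro : ∀ {b} → ¬ T b → T (not b)
  T-not-intro {false} _ = tt
  T-not-intro {true}  h = h tt

  T-not-elim : ∀ {b} → T (not b) → ¬ T b
  T-not-elim {false} _ ()

  _≡ᵇ_ : ∀ {n} → Fin n → Fin n → Bool
  u ≡ᵇ v = ⌊ u ≟ v ⌋

  ≡ᵇ-refl : ∀ {n} (v : Fin n) → T (v ≡ᵇ v)
  ≡ᵇ-refl v with v ≟ v
  ... | yes _ = tt
  ... | no v≢v = v≢v refl

  ≡ᵇ-sound : ∀ {n} {u v : Fin n} → T (u ≡ᵇ v) → u ≡ v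
  ≡ᵇ-sound {u = u} {v} t with u ≟ v
  ... | yes u≡v = u≡v

  count-≤ : ∀ {n} (P : Fin n → Bool) → count P ≤ n
  count-≤ {zero}  P = z≤n
  count-≤ {suc n} P with P zero
  ... | true  = s≤s (count-≤ (λ i → P (suc i)))
  ... | false = m≤n⇒m≤1+n (count-≤ (λ i → P (suc i)))

  count-mono : ∀ {n} (P Q : Fin n → Bool) → (∀ v → T (P v) → T (Q v)) →
               count P ≤ count Q
  count-mono {zero}  P Q P⊆Q = z≤n
  count-mono {suc n} P Q P⊆Q with P zero in eP | Q zero in eQ
  ... | true  | true  = s≤s (count-mono _ _ (λ v → P⊆Q (suc v)))
  ... | true  | false = ⊥-elim (subst T eQ (P⊆Q zero (subst T (sym eP) tt)))
  ... | false | true  = m≤n⇒m≤1+n (count-mono _ _ (λ v → P⊆Q (suc v)))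
  ... | false | false = count-mono _ _ (λ v → P⊆Q (suc v))

  count-cong : ∀ {n} (P Q : Fin n → Bool) → (∀ v → P v ≡ Q v) → count P ≡ count Q
  count-cong P Q P≡Q = ≤-antisym (count-mono P Q (λ v → subst T (P≡Q v)))
                                 (count-mono Q P (λ v → subst T (sym (P≡Q v))))

  count-split : ∀ {n} (P Q : Fin n → Bool) →
                count P ≡ count (λ v → P v ∧ Q v) + count (λ v → P v ∧ not (Q v))
  count-split {zero}  P Q = refl
  count-split {suc n} P Q with P zero | Q zero
  ... | true  | true  = cong suc (count-split P′ Q′)
    where P′ = λ i → P (suc i); Q′ = λ i → Q (suc i)
  ... | true  | false = trans (cong suc (count-split P′ Q′))
                              (sym (+-suc (count (λ v → P′ v ∧ Q′ v)) _))
    where P′ = λ i → P (suc i); Q′ = λ i → Q (suc i)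
  ... | false | true  = count-split P′ Q′
    where P′ = λ i → P (suc i); Q′ = λ i → Q (suc i)
  ... | false | false = count-split P′ Q′
    where P′ = λ i → P (suc i); Q′ = λ i → Q (suc i)

  count-∨ : ∀ {n} (P Q : Fin n → Bool) → count (λ v → P v ∨ Q v) ≤ count P + count Q
  count-∨ {zero}  P Q = z≤n
  count-∨ {suc n} P Q with P zero | Q zero
  ... | true  | true  = s≤s (≤-trans (count-∨ P′ Q′)
                          (≤-trans (n≤1+n _) (≤-reflexive (sym (+-suc (count P′) _)))))
    where P′ = λ i → P (suc i); Q′ = λ i → Q (suc i)
  ... | true  | false = s≤s (count-∨ P′ Q′)
    where P′ = λ i → P (suc i); Q′ = λ i → Q (suc i)
  ... | false | true  = ≤-trans (s≤s (count-∨ P′ Q′)) (≤-reflexive (sym (+-suc (count P′) _)))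
    where P′ = λ i → P (suc i); Q′ = λ i → Q (suc i)
  ... | false | false = count-∨ P′ Q′
    where P′ = λ i → P (suc i); Q′ = λ i → Q (suc i)

  count-singleton : ∀ {n} (w : Fin n) → count (_≡ᵇ w) ≤ 1
  count-singleton {suc n} zero = s≤s (≤-reflexive (no-zero n))
    where
    no-zero : ∀ m → count {m} (λ v → suc v ≡ᵇ zero) ≡ 0
    no-zero zero    = refl
    no-zero (suc m) = no-zero m
  count-singleton {suc n} (suc w) =
    ≤-trans (≤-reflexive (count-cong _ _ suc-test)) (count-singleton w)
    where
    suc-test : ∀ v → (suc v ≡ᵇ suc w) ≡ (v ≡ᵇ w)
    suc-test v with v ≟ w
    ... | yes refl = refl
    ... | no _     = refl

  count-pos : ∀ {n} (P : Fin n → Bool) v → T (P v) → 1 ≤ count P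
  count-pos {suc n} P zero    Pv with P zero
  ... | true = s≤s z≤n
  count-pos {suc n} P (suc v) Pv with P zero
  ... | true  = s≤s z≤n
  ... | false = count-pos (λ i → P (suc i)) v Pv

  elems : ∀ {n} (P : Fin n → Bool) → List (Fin n)
  elems {zero}  P = []
  elems {suc n} P with P zero
  ... | true  = zero ∷ map suc (elems (λ i → P (suc i)))
  ... | false = map suc (elems (λ i → P (suc i)))

  elems-length : ∀ {n} (P : Fin n → Bool) → length (elems P) ≡ count P
  elems-length {zero}  P = refl
  elems-length {suc n} P with P zero
  ... | true  = cong suc (trans (length-map suc (elems P′)) (elems-length P′))
    where P′ = λ i → P (suc i)
  ... | false = trans (length-map suc (elems P′)) (elems-length P′)
    where P′ = λ i → P (suc i)

  elems-unique : ∀ {n} (P : Fin n → Bool) → Unique (elems P)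
  elems-unique {zero}  P = []
  elems-unique {suc n} P with P zero
  ... | true  = All.tabulate zero∉ ∷ UniqueP.map⁺ suc-injective (elems-unique _)
    where
    zero∉ : ∀ {y} → y ∈ map suc (elems (λ i → P (suc i))) → zero ≢ y
    zero∉ y∈ with ∈-map⁻ suc y∈
    ... | _ , _ , refl = λ ()
  ... | false = UniqueP.map⁺ suc-injective (elems-unique _)

  elems-all : ∀ {n} (P : Fin n → Bool) → All (λ v → T (P v)) (elems P)
  elems-all {zero}  P = []
  elems-all {suc n} P with P zero in e
  ... | true  = subst T (sym e) tt ∷ AllP.map⁺ (elems-all _)
  ... | false = AllP.map⁺ (elems-all _)

  unique-count : ∀ {n} (P : Fin n → Bool) (xs : List (Fin n)) → Unique xs →
                 All (λ v → T (P v)) xs → length xs ≤ count P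
  unique-count P []       _          _          = z≤n
  unique-count P (x ∷ xs) (x∉ ∷ uxs) (Px ∷ Pxs) = begin
    suc (length xs)                                     ≤⟨ s≤s (unique-count P∖x xs uxs (rest xs x∉ Pxs)) ⟩
    suc (count P∖x)                                     ≡⟨ +-comm 1 _ ⟩
    count P∖x + 1                                       ≤⟨ +-monoʳ-≤ (count P∖x) (count-pos _ x (T-∧-intro Px (≡ᵇ-refl x))) ⟩
    count P∖x + count (λ v → P v ∧ (v ≡ᵇ x))            ≡⟨ +-comm (count P∖x) _ ⟩
    count (λ v → P v ∧ (v ≡ᵇ x)) + count P∖x            ≡⟨ count-split P (_≡ᵇ x) ⟨
    count P                                             ∎
    where
    open ≤-Reasoning
    P∖x : Fin _ → Bool
    P∖x v = P v ∧ not (v ≡ᵇ x)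
    rest : ∀ ys → All (x ≢_) ys → All (λ v → T (P v)) ys → All (λ v → T (P∖x v)) ys
    rest []       _          _          = []
    rest (y ∷ ys) (x≢y ∷ ne) (Py ∷ Pys) =
      T-∧-intro Py (T-not-intro (λ t → x≢y (sym (≡ᵇ-sound t)))) ∷ rest ys ne Pys

  count-inj : ∀ {n} (f : Fin n → Fin n) → (∀ {u v} → f u ≡ f v → u ≡ v) →
              (P : Fin n → Bool) → count (λ v → P (f v)) ≤ count P
  count-inj f f-inj P = begin
    count (λ v → P (f v))               ≡⟨ elems-length (λ v → P (f v)) ⟨
    length (elems (λ v → P (f v)))      ≡⟨ length-map f (elems (λ v → P (f v))) ⟨
    length (map f (elems (λ v → P (f v)))) ≤⟨ unique-count P _ (UniqueP.map⁺ f-inj (elems-unique _))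
                                               (AllP.map⁺ (elems-all _)) ⟩
    count P                             ∎
    where open ≤-Reasoning

module CyclePositions where

  open import Data.Nat as ℕ using (ℕ; zero; suc; _+_; _*_; _∸_; _≤_; _<_; _%_; _/_)
  open import Data.Nat.Properties
  open import Data.Nat.DivMod using (m≡m%n+[m/n]*n; m%n<n)
  open import Data.Fin using (Fin; toℕ; fromℕ<)
  open import Data.Fin.Properties using (pigeonhole; injective⇒≤; toℕ-fromℕ<; toℕ<n)
  open import Data.Product using (∃-syntax; _,_; proj₁; proj₂)
  open import Data.Empty using (⊥-elim)
  open import Function using (Injective)
  open import Relation.Binary.Definitions using (tri<; tri≈; tri>)
  open import Relation.Binary.PropositionalEquality

  iter-+ : ∀ {n} (π : Fin n → Fin n) k l v → iter π (k + l) v ≡ iter π k (iter π l v)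
  iter-+ π zero    l v = refl
  iter-+ π (suc k) l v = cong π (iter-+ π k l v)

  -- A permutation π of Fin n with a single orbit, numbered from a base vertex z₀:
  -- c k = π^k(z₀).  Every vertex is c k for a unique k < n, and π⁻¹ is π^(n-1).
  module Numbering {n : ℕ} (π : Fin n → Fin n) (π-inj : Injective _≡_ _≡_ π)
                   (reach : ∀ u v → ∃[ k ] iter π k u ≡ v) (z₀ : Fin n) (n>0 : 0 < n) where

    c : ℕ → Fin n
    c k = iter π k z₀

    iter-cancel : ∀ k {u v} → iter π k u ≡ iter π k v → u ≡ v
    iter-cancel zero    e = e
    iter-cancel (suc k) e = iter-cancel k (π-inj e)

    return-time : ∀ k d → c (d + k) ≡ c k → c d ≡ z₀
    return-time k d e = iter-cancel k (begin
      iter π k (c d)  ≡⟨ iter-+ π k d z₀ ⟨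
      c (k + d)       ≡⟨ cong c (+-comm k d) ⟩
      c (d + k)       ≡⟨ e ⟩
      c k             ∎)
      where open ≡-Reasoning

    return-mod : ∀ d .{{_ : ℕ.NonZero d}} → c d ≡ z₀ → ∀ k → c k ≡ c (k % d)
    return-mod d cd≡z₀ k = begin
      c k                               ≡⟨ cong c (m≡m%n+[m/n]*n k d) ⟩
      c (k % d + (k / d) * d)           ≡⟨ iter-+ π (k % d) ((k / d) * d) z₀ ⟩
      iter π (k % d) (c ((k / d) * d))  ≡⟨ cong (iter π (k % d)) (multiples (k / d)) ⟩
      c (k % d)                         ∎
      where
      open ≡-Reasoning
      multiples : ∀ q → c (q * d) ≡ z₀
      multiples zero    = refl
      multiples (suc q) = trans (iter-+ π d (q * d) z₀)
                                (trans (cong (iter π d) (multiples q)) cd≡z₀)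

    -- A positive return time is at least n: otherwise k ↦ k mod d would inject
    -- all n vertices into d < n residues.
    return-time-≥ : ∀ d → 0 < d → c d ≡ z₀ → n ≤ d
    return-time-≥ d@(suc _) _ cd≡z₀ = injective⇒≤ {f = residue} residue-inj
      where
      residue : Fin n → Fin d
      residue v = fromℕ< (m%n<n (proj₁ (reach z₀ v)) d)
      c-residue : ∀ v → c (toℕ (residue v)) ≡ v
      c-residue v = trans (cong c (toℕ-fromℕ< (m%n<n (proj₁ (reach z₀ v)) d)))
                          (trans (sym (return-mod d cd≡z₀ (proj₁ (reach z₀ v))))
                                 (proj₂ (reach z₀ v)))
      residue-inj : Injective _≡_ _≡_ residue
      residue-inj {u} {v} e =
        trans (sym (c-residue u)) (trans (cong (λ i → c (toℕ i)) e) (c-residue v))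

    instance
      n-nonZero : ℕ.NonZero n
      n-nonZero = ℕ.>-nonZero n>0

    -- By pigeonhole some return time is at most n, so it is exactly n.
    period : c n ≡ z₀
    period with pigeonhole (n<1+n n) (λ (i : Fin (suc n)) → c (toℕ i))
    ... | i , j , i<j , ci≡cj = subst (λ m → c m ≡ z₀) d≡n cd≡z₀
      where
      d = toℕ j ∸ toℕ i
      cd≡z₀ : c d ≡ z₀
      cd≡z₀ = return-time (toℕ i) d (trans (cong c (m∸n+n≡m (<⇒≤ i<j))) (sym ci≡cj))
      d≡n : d ≡ n
      d≡n = ≤-antisym (≤-trans (m∸n≤m (toℕ j) (toℕ i)) (≤-pred (toℕ<n j)))
                      (return-time-≥ d (m<n⇒0<n∸m i<j) cd≡z₀)

    no-short-return : ∀ {k l} → k < l → l < n → c l ≢ c k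
    no-short-return {k} {l} k<l l<n e = <⇒≱ (≤-<-trans (m∸n≤m l k) l<n)
      (return-time-≥ (l ∸ k) (m<n⇒0<n∸m k<l)
        (return-time k (l ∸ k) (trans (cong c (m∸n+n≡m (<⇒≤ k<l))) e)))

    c-inj : ∀ {k l} → k < n → l < n → c k ≡ c l → k ≡ l
    c-inj {k} {l} k<n l<n e with <-cmp k l
    ... | tri< k<l _ _ = ⊥-elim (no-short-return k<l l<n (sym e))
    ... | tri≈ _ k≡l _ = k≡l
    ... | tri> _ _ l<k = ⊥-elim (no-short-return l<k k<n e)

    c-+n : ∀ k → c (k + n) ≡ c k
    c-+n k = trans (iter-+ π k n z₀) (cong (iter π k) period)

    pos : Fin n → ℕ
    pos v = proj₁ (reach z₀ v) % n

    pos<n : ∀ v → pos v < n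
    pos<n v = m%n<n (proj₁ (reach z₀ v)) n

    c-pos : ∀ v → c (pos v) ≡ v
    c-pos v = trans (sym (return-mod n period (proj₁ (reach z₀ v)))) (proj₂ (reach z₀ v))

    pred : Fin n → Fin n
    pred v = c (pos v + (n ∸ 1))

    π-pred : ∀ v → π (pred v) ≡ v
    π-pred v = begin
      c (suc (pos v + (n ∸ 1)))  ≡⟨ cong c (+-suc (pos v) (n ∸ 1)) ⟨
      c (pos v + suc (n ∸ 1))    ≡⟨ cong (λ m → c (pos v + m)) (m+[n∸m]≡n {1} {n} n>0) ⟩
      c (pos v + n)              ≡⟨ c-+n (pos v) ⟩
      c (pos v)                  ≡⟨ c-pos v ⟩
      v                          ∎
      where open ≡-Reasoning

    pred-π : ∀ v → pred (π v) ≡ v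
    pred-π v = π-inj (π-pred (π v))

    pred-inj : ∀ {u v} → pred u ≡ pred v → u ≡ v
    pred-inj {u} {v} e = trans (sym (π-pred u)) (trans (cong π e) (π-pred v))

    pred-c : ∀ k → pred (c (suc k)) ≡ c k
    pred-c k = π-inj (π-pred (c (suc k)))

module Switchings where

  open import Data.Bool using (T)
  open import Data.Product using (_×_; _,_)
  open import Data.Sum using (inj₁; inj₂)
  open import Relation.Binary.PropositionalEquality

  E-sym : ∀ {n} (G : Graph n) {u v} → E G u v → E G v u
  E-sym G {u} {v} = subst T (Graph.sym G u v)

  E-same : ∀ {n} (G : Graph n) {u v a b} → E G a b → SameEdge u v a b → E G u v
  E-same G e (inj₁ (refl , refl)) = e
  E-same G e (inj₂ (refl , refl)) = E-sym G e

  -- The two edges that s_i(H; xπ(x), x'y') adds besides x'y', written in terms of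
  -- w₁ = π(x') and w₂ = π⁻¹(y').
  AddedEdges : ∀ {n} → Graph n → (Fin n → Fin n) → SwitchType → (x w₁ w₂ : Fin n) → Set
  AddedEdges G π s₁ x w₁ w₂ = E G x w₁ × E G w₂ (π x)
  AddedEdges G π s₂ x w₁ w₂ = E G x w₂ × E G (π x) w₁

  -- Every other edge of H_i is an edge of the Hamilton cycle, so H_i ⊆ G as soon
  -- as x'y' and the two added edges lie in G.
  admissible : ∀ {n} (G : Graph n) (π : Fin n → Fin n) → (∀ v → E G v (π v)) →
    ∀ i x x' y' w₂ → E G x' y' → (∀ p → π p ≡ y' → p ≡ w₂) →
    AddedEdges G π i x (π x') w₂ → Admissible G π i x x' y'
  admissible G π π-edge i x x' y' w₂ e′ pred-y' added p πp≡y' u v = edge-of-Hᵢ i added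
    where
    edge-of-Hᵢ : ∀ i → AddedEdges G π i x (π x') w₂ → EdgeHi π i x x' y' p u v → E G u v
    edge-of-Hᵢ _  _         (inj₁ (inj₁ refl , _))      = π-edge u
    edge-of-Hᵢ _  _         (inj₁ (inj₂ refl , _))      = E-sym G (π-edge v)
    edge-of-Hᵢ _  _         (inj₂ (inj₁ s))             = E-same G e′ s
    edge-of-Hᵢ s₁ (ex , _)  (inj₂ (inj₂ (inj₁ s)))      = E-same G ex s
    edge-of-Hᵢ s₁ (_ , ew)  (inj₂ (inj₂ (inj₂ s)))      =
      E-same G (subst (λ w → E G w (π x)) (sym (pred-y' p πp≡y')) ew) s
    edge-of-Hᵢ s₂ (ew , _)  (inj₂ (inj₂ (inj₁ s)))      =
      E-same G (subst (E G x) (sym (pred-y' p πp≡y')) ew) s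
    edge-of-Hᵢ s₂ (_ , ex)  (inj₂ (inj₂ (inj₂ s)))      = E-same G ex s

module Pairing where

  open import Data.Nat using (ℕ; suc; _+_; _*_; _≤_)
  open import Data.Nat.Properties using (*-zeroʳ; *-suc; +-mono-≤; *-distribˡ-+; ≤-reflexive; module ≤-Reasoning)
  open import Data.Product using (∃-syntax; _×_; _,_)
  open import Data.Sum using (inj₁; inj₂)
  open import Data.List using (List; []; _∷_; length; map; _++_)
  open import Data.List.Properties using (length-map; length-++)
  open import Data.List.Relation.Unary.All as All using (All; []; _∷_)
  import Data.List.Relation.Unary.All.Properties as AllP
  open import Data.List.Relation.Unary.AllPairs using ([]; _∷_)
  open import Data.List.Relation.Unary.Any using (here; there)
  open import Data.List.Relation.Unary.Unique.Propositional using (Unique)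
  import Data.List.Relation.Unary.Unique.Propositional.Properties as UniqueP
  open import Data.List.Membership.Propositional using (_∈_)
  open import Data.List.Membership.Propositional.Properties using (∈-map⁻; ∈-++⁻)
  open import Relation.Binary.PropositionalEquality
  open import Relation.Nullary using (¬_)

  module _ {A C : Set} (f : A → A → C) (row : A → List A) where

    pairs : List A → List C
    pairs []       = []
    pairs (p ∷ ps) = map (f p) (row p) ++ pairs ps

    pairs-∈ : ∀ ps {t} → t ∈ pairs ps → ∃[ p ] ∃[ q ] p ∈ ps × t ≡ f p q
    pairs-∈ (p ∷ ps) t∈ with ∈-++⁻ (map (f p) (row p)) t∈
    ... | inj₁ t∈row with ∈-map⁻ (f p) t∈row
    ...   | q , _ , t≡ = p , q , here refl , t≡
    pairs-∈ (p ∷ ps) t∈ | inj₂ t∈rest with pairs-∈ ps t∈rest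
    ... | p′ , q′ , p′∈ , t≡ = p′ , q′ , there p′∈ , t≡

    pairs-unique : (∀ {p q p′ q′} → f p q ≡ f p′ q′ → p ≡ p′) →
                   (∀ {p q q′} → f p q ≡ f p q′ → q ≡ q′) →
                   (∀ p → Unique (row p)) → ∀ ps → Unique ps → Unique (pairs ps)
    pairs-unique _     _     _       []       _          = []
    pairs-unique inj-p inj-q row-unq (p ∷ ps) (p∉ ∷ unq) =
      UniqueP.++⁺ (UniqueP.map⁺ inj-q (row-unq p))
                  (pairs-unique inj-p inj-q row-unq ps unq) disjoint
      where
      disjoint : ∀ {t} → ¬ (t ∈ map (f p) (row p) × t ∈ pairs ps)
      disjoint (t∈row , t∈rest) with ∈-map⁻ (f p) t∈row | pairs-∈ ps t∈rest
      ... | q , _ , refl | p′ , q′ , p′∈ , e = All.lookup p∉ p′∈ (inj-p e)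

    pairs-all : {P : A → Set} {Good : C → Set} →
                (∀ p → P p → All (λ q → Good (f p q)) (row p)) →
                ∀ ps → All P ps → All Good (pairs ps)
    pairs-all good []       []         = []
    pairs-all good (p ∷ ps) (Pp ∷ Pps) =
      AllP.++⁺ (AllP.map⁺ (good p Pp)) (pairs-all good ps Pps)

    pairs-length : {P : A → Set} (k r : ℕ) → (∀ p → P p → k ≤ r * length (row p)) →
                   ∀ ps → All P ps → k * length ps ≤ r * length (pairs ps)
    pairs-length k r long []       []         = ≤-reflexive (trans (*-zeroʳ k) (sym (*-zeroʳ r)))
    pairs-length k r long (p ∷ ps) (Pp ∷ Pps) = begin
      k * suc (length ps)                                  ≡⟨ *-suc k (length ps) ⟩
      k + k * length ps                                    ≤⟨ +-mono-≤ (long p Pp) (pairs-length k r long ps Pps) ⟩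
      r * length (row p) + r * length (pairs ps)           ≡⟨ cong (λ l → r * l + r * length (pairs ps))
                                                                  (length-map (f p) (row p)) ⟨
      r * length (map (f p) (row p)) + r * length (pairs ps) ≡⟨ *-distribˡ-+ r _ _ ⟨
      r * (length (map (f p) (row p)) + length (pairs ps)) ≡⟨ cong (r *_) (length-++ (map (f p) (row p))) ⟨
      r * length (pairs (p ∷ ps))                          ∎
      where open ≤-Reasoning

module Estimates where

  open import Data.Nat using (_+_; _*_; _≤_)
  open import Data.Nat.Properties
  open import Data.Nat.Tactic.RingSolver using (solve-∀)
  open import Relation.Binary.PropositionalEquality

  -- Partners: the degree d_b ≥ 0.24n of b is spent on at most cQ partners, on the
  -- B-vertices outside N(π⁻¹p) and N(πp) (each set has size |B| - d_i with
  -- d_i ≥ 0.49n and |B| ≤ 0.505n), and on ≤ 3 vertices near e; so cQ ≥ n/5.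
  partners-estimate : ∀ n d_b d₁ d₂ cQ miss₁ miss₂ near nB →
    d_b ≤ cQ + (miss₁ + (miss₂ + near)) → near ≤ 3 →
    nB ≡ d₁ + miss₁ → nB ≡ d₂ + miss₂ →
    49 * n ≤ 100 * d₁ → 49 * n ≤ 100 * d₂ → 24 * n ≤ 100 * d_b →
    200 * nB ≤ 101 * n → 300 ≤ n → n ≤ 5 * cQ
  partners-estimate n d_b d₁ d₂ cQ miss₁ miss₂ near nB
                    cover near≤3 e₁ e₂ deg₁ deg₂ deg-b |B|≤ n≥300 =
    *-cancelˡ-≤ 20 (+-cancelʳ-≤ (102 * n) (20 * n) (20 * (5 * cQ)) (begin
      20 * n + 102 * n                                     ≡⟨ expand-n n ⟩
      24 * n + 49 * n + 49 * n                             ≤⟨ +-mono-≤ (+-mono-≤ deg-b deg₁) deg₂ ⟩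
      100 * d_b + 100 * d₁ + 100 * d₂                      ≤⟨ +-monoˡ-≤ (100 * d₂) (+-monoˡ-≤ (100 * d₁) (*-monoʳ-≤ 100 cover)) ⟩
      100 * (cQ + (miss₁ + (miss₂ + near))) + 100 * d₁ + 100 * d₂
                                                           ≡⟨ regroup cQ miss₁ miss₂ near d₁ d₂ ⟩
      100 * cQ + (100 * (d₁ + miss₁) + 100 * (d₂ + miss₂)) + 100 * near
                                                           ≡⟨ cong₂ (λ u w → 100 * cQ + (100 * u + 100 * w) + 100 * near) e₁ e₂ ⟨
      100 * cQ + (100 * nB + 100 * nB) + 100 * near        ≡⟨ cong (λ u → 100 * cQ + u + 100 * near) (double nB) ⟩
      100 * cQ + 200 * nB + 100 * near                     ≤⟨ +-mono-≤ (+-monoʳ-≤ (100 * cQ) |B|≤) (*-monoʳ-≤ 100 near≤3) ⟩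
      100 * cQ + 101 * n + 300                             ≤⟨ +-monoʳ-≤ (100 * cQ + 101 * n) n≥300 ⟩
      100 * cQ + 101 * n + n                               ≡⟨ collect cQ n ⟩
      20 * (5 * cQ) + 102 * n                              ∎))
    where
    open ≤-Reasoning
    expand-n : ∀ n → 20 * n + 102 * n ≡ 24 * n + 49 * n + 49 * n
    expand-n = solve-∀
    regroup : ∀ cQ m₁ m₂ r d₁ d₂ → 100 * (cQ + (m₁ + (m₂ + r))) + 100 * d₁ + 100 * d₂
                                 ≡ 100 * cQ + (100 * (d₁ + m₁) + 100 * (d₂ + m₂)) + 100 * r
    regroup = solve-∀
    double : ∀ k → 100 * k + 100 * k ≡ 200 * k
    double = solve-∀
    collect : ∀ cQ n → 100 * cQ + 101 * n + n ≡ 20 * (5 * cQ) + 102 * n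
    collect = solve-∀

  -- Pivots: the degree d_a ≥ 9 of a is spent on cP pivots, on two sets of size m
  -- and two of size cX (each ≤ d_a/100), and on ≤ 3 vertices near e; so cP ≥ d_a/2.
  pivots-estimate : ∀ d_a cP m cX near →
    d_a ≤ cP + (m + (cX + (m + (cX + near)))) → near ≤ 3 →
    100 * m ≤ d_a → 100 * cX ≤ d_a → 9 ≤ d_a → d_a ≤ 2 * cP
  pivots-estimate d_a cP m cX near cover near≤3 m≤ cX≤ d_a≥9 =
    *-cancelˡ-≤ 100 (+-cancelʳ-≤ 600 (100 * d_a) (100 * (2 * cP)) (begin
      100 * d_a + 600        ≤⟨ +-monoʳ-≤ (100 * d_a) (≤-trans (m≤m+n 600 228) (*-monoʳ-≤ 92 d_a≥9)) ⟩
      100 * d_a + 92 * d_a   ≡⟨ split-192 d_a ⟩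
      2 * (96 * d_a)         ≤⟨ *-monoʳ-≤ 2 most-of-d_a ⟩
      2 * (100 * cP + 300)   ≡⟨ distribute cP ⟩
      100 * (2 * cP) + 600   ∎))
    where
    open ≤-Reasoning
    most-of-d_a : 96 * d_a ≤ 100 * cP + 300
    most-of-d_a = +-cancelʳ-≤ (4 * d_a) (96 * d_a) (100 * cP + 300) (begin
      96 * d_a + 4 * d_a     ≡⟨ add-100 d_a ⟩
      100 * d_a              ≤⟨ *-monoʳ-≤ 100 cover ⟩
      100 * (cP + (m + (cX + (m + (cX + near)))))
                             ≡⟨ regroup cP m cX near ⟩
      100 * cP + ((100 * m + 100 * m) + (100 * cX + 100 * cX)) + 100 * near
                             ≤⟨ +-mono-≤ (+-monoʳ-≤ (100 * cP) (+-mono-≤ (+-mono-≤ m≤ m≤) (+-mono-≤ cX≤ cX≤)))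
                                         (*-monoʳ-≤ 100 near≤3) ⟩
      100 * cP + ((d_a + d_a) + (d_a + d_a)) + 300
                             ≡⟨ collect cP d_a ⟩
      100 * cP + 300 + 4 * d_a ∎)
      where
      add-100 : ∀ d → 96 * d + 4 * d ≡ 100 * d
      add-100 = solve-∀
      regroup : ∀ cP m cX r → 100 * (cP + (m + (cX + (m + (cX + r)))))
                            ≡ 100 * cP + ((100 * m + 100 * m) + (100 * cX + 100 * cX)) + 100 * r
      regroup = solve-∀
      collect : ∀ cP d → 100 * cP + ((d + d) + (d + d)) + 300 ≡ 100 * cP + 300 + 4 * d
      collect = solve-∀
    split-192 : ∀ d → 100 * d + 92 * d ≡ 2 * (96 * d)
    split-192 = solve-∀
    distribute : ∀ cP → 2 * (100 * cP + 300) ≡ 100 * (2 * cP) + 600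
    distribute = solve-∀

module Rationals where

  open import Data.Nat as ℕ using (suc; z≤n; s≤s)
  import Data.Nat.Properties as ℕP
  import Data.Nat.Coprimality as Coprimality
  open import Data.Integer as ℤ using (+_; -[1+_])
  import Data.Integer.Properties as ℤP
  open import Data.Rational as ℚ
    using (ℚ; mkℚ; _≤_; _<_; _*_; _-_; ½; 0ℚ; NonNegative; 1/_)
  open import Data.Rational.Properties
  open import Data.Rational.Solver using (module +-*-Solver)
  open import Data.Product using (∃-syntax; _,_; proj₁; proj₂)
  open import Relation.Binary.PropositionalEquality

  ⟦⟧-normal : ∀ n → ⟦ n ⟧ ≡ mkℚ (+ n) 0 (Coprimality.sym (Coprimality.1-coprimeTo n))
  ⟦⟧-normal n = normalize-coprime (Coprimality.sym (Coprimality.1-coprimeTo n))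

  ⟦⟧-mono : ∀ {a b} → a ℕ.≤ b → ⟦ a ⟧ ≤ ⟦ b ⟧
  ⟦⟧-mono {a} {b} a≤b rewrite ⟦⟧-normal a | ⟦⟧-normal b =
    ℚ.*≤* (subst₂ ℤ._≤_ (sym (ℤP.*-identityʳ (+ a))) (sym (ℤP.*-identityʳ (+ b))) (ℤ.+≤+ a≤b))

  ⟦⟧-reflects-≤ : ∀ {a b} → ⟦ a ⟧ ≤ ⟦ b ⟧ → a ℕ.≤ b
  ⟦⟧-reflects-≤ {a} {b} h rewrite ⟦⟧-normal a | ⟦⟧-normal b =
    ℤP.drop‿+≤+ (subst₂ ℤ._≤_ (ℤP.*-identityʳ (+ a)) (ℤP.*-identityʳ (+ b)) (drop-*≤* h))

  ⟦⟧-* : ∀ a b → ⟦ a ℕ.* b ⟧ ≡ ⟦ a ⟧ * ⟦ b ⟧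
  ⟦⟧-* a b rewrite ⟦⟧-normal a | ⟦⟧-normal b = cong (ℚ._/ 1) (sym (ℤP.+◃n≡+n (a ℕ.* b)))

  ⟦⟧-nonNeg : ∀ n → NonNegative ⟦ n ⟧
  ⟦⟧-nonNeg n = ℚ.nonNegative (⟦⟧-mono {0} {n} z≤n)

  ⟦⟧-unbounded : ∀ r → ∃[ k ] r ≤ ⟦ k ⟧
  ⟦⟧-unbounded (mkℚ -[1+ a ] d c) = 0 , ℚ.*≤* ℤ.-≤+
  ⟦⟧-unbounded (mkℚ (+ a) d c) = a , subst (mkℚ (+ a) d c ≤_) (sym (⟦⟧-normal a)) (ℚ.*≤* a≤a·d)
    where
    a≤a·d : (+ a) ℤ.* (+ 1) ℤ.≤ (+ a) ℤ.* (+ suc d)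
    a≤a·d rewrite ℤP.+◃n≡+n (a ℕ.* 1) | ℤP.+◃n≡+n (a ℕ.* suc d) =
      ℤ.+≤+ (ℕP.*-monoʳ-≤ a (s≤s z≤n))

  *⟦⟧-mono : ∀ {r s} n → r ≤ s → r * ⟦ n ⟧ ≤ s * ⟦ n ⟧
  *⟦⟧-mono n = *-monoʳ-≤-nonNeg ⟦ n ⟧ {{⟦⟧-nonNeg n}}

  ⟦⟧*-mono : ∀ {r s} n → r ≤ s → ⟦ n ⟧ * r ≤ ⟦ n ⟧ * s
  ⟦⟧*-mono n = *-monoˡ-≤-nonNeg ⟦ n ⟧ {{⟦⟧-nonNeg n}}

  clear-denominator : ∀ k l n d (r s : ℚ) → ⟦ k ⟧ ≡ ⟦ l ⟧ * r → r ≤ s →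
                      s * ⟦ n ⟧ ≤ ⟦ d ⟧ → k ℕ.* n ℕ.≤ l ℕ.* d
  clear-denominator k l n d r s k≡l·r r≤s s·n≤d = ⟦⟧-reflects-≤ (begin
    ⟦ k ℕ.* n ⟧          ≡⟨ ⟦⟧-* k n ⟩
    ⟦ k ⟧ * ⟦ n ⟧        ≡⟨ cong (_* ⟦ n ⟧) k≡l·r ⟩
    (⟦ l ⟧ * r) * ⟦ n ⟧  ≡⟨ *-assoc ⟦ l ⟧ r ⟦ n ⟧ ⟩
    ⟦ l ⟧ * (r * ⟦ n ⟧)  ≤⟨ ⟦⟧*-mono l (*⟦⟧-mono n r≤s) ⟩
    ⟦ l ⟧ * (s * ⟦ n ⟧)  ≤⟨ ⟦⟧*-mono l s·n≤d ⟩
    ⟦ l ⟧ * ⟦ d ⟧        ≡⟨ ⟦⟧-* l d ⟨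
    ⟦ l ℕ.* d ⟧          ∎)
    where open ≤-Reasoning

  η₀ : ℚ
  η₀ = + 1 ℚ./ 100

  half-degree : ∀ η n d → η ≤ η₀ → (½ - η) * ⟦ n ⟧ ≤ ⟦ d ⟧ → 49 ℕ.* n ℕ.≤ 100 ℕ.* d
  half-degree η n d η≤η₀ = clear-denominator 49 100 n d (+ 49 ℚ./ 100) (½ - η) refl
    (+-monoʳ-≤ ½ (neg-antimono-≤ η≤η₀))

  quarter-degree : ∀ η n d → η ≤ η₀ → (¼ - η) * ⟦ n ⟧ ≤ ⟦ d ⟧ → 24 ℕ.* n ℕ.≤ 100 ℕ.* d
  quarter-degree η n d η≤η₀ = clear-denominator 24 100 n d (+ 24 ℚ./ 100) (¼ - η) refl
    (+-monoʳ-≤ ¼ (neg-antimono-≤ η≤η₀))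

  1/100 1/10 : ℚ
  1/100 = + 1 ℚ./ 100
  1/10  = + 1 ℚ./ 10

  tiny-vs-degree : ∀ (α ν : ℚ) k n d → α ≤ ν * 1/100 → ν * ⟦ n ⟧ ≤ ⟦ d ⟧ →
                   ⟦ k ⟧ ≤ α * ⟦ n ⟧ → 100 ℕ.* k ℕ.≤ d
  tiny-vs-degree α ν k n d α≤ ν·n≤d k≤α·n = ⟦⟧-reflects-≤ (begin
    ⟦ 100 ℕ.* k ⟧                ≡⟨ ⟦⟧-* 100 k ⟩
    ⟦ 100 ⟧ * ⟦ k ⟧              ≤⟨ ⟦⟧*-mono 100 k≤α·n ⟩
    ⟦ 100 ⟧ * (α * ⟦ n ⟧)        ≤⟨ ⟦⟧*-mono 100 (*⟦⟧-mono n α≤) ⟩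
    ⟦ 100 ⟧ * ((ν * 1/100) * ⟦ n ⟧) ≡⟨ cancel ν ⟦ n ⟧ ⟩
    ν * ⟦ n ⟧                    ≤⟨ ν·n≤d ⟩
    ⟦ d ⟧                        ∎)
    where
    open ≤-Reasoning
    open +-*-Solver using (solve; _:*_; _:=_; con)
    cancel : ∀ a b → ⟦ 100 ⟧ * ((a * 1/100) * b) ≡ a * b
    cancel = solve 2 (λ a b → con ⟦ 100 ⟧ :* ((a :* con 1/100) :* b) := a :* b) refl

  quadratic-count : ∀ (β ν : ℚ) n d len → β ≤ ν * 1/10 → ν * ⟦ n ⟧ ≤ ⟦ d ⟧ →
                    d ℕ.* n ℕ.≤ 10 ℕ.* len → β * (⟦ n ⟧ * ⟦ n ⟧) ≤ ⟦ len ⟧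
  quadratic-count β ν n d len β≤ ν·n≤d d·n≤10len = begin
    β * (⟦ n ⟧ * ⟦ n ⟧)          ≤⟨ *-monoʳ-≤-nonNeg (⟦ n ⟧ * ⟦ n ⟧) {{n²-nonNeg}} β≤ ⟩
    (ν * 1/10) * (⟦ n ⟧ * ⟦ n ⟧) ≡⟨ regroup ν ⟦ n ⟧ ⟩
    1/10 * ((ν * ⟦ n ⟧) * ⟦ n ⟧) ≤⟨ *-monoˡ-≤-nonNeg 1/10 (*⟦⟧-mono n ν·n≤d) ⟩
    1/10 * (⟦ d ⟧ * ⟦ n ⟧)       ≡⟨ cong (1/10 *_) (⟦⟧-* d n) ⟨
    1/10 * ⟦ d ℕ.* n ⟧           ≤⟨ *-monoˡ-≤-nonNeg 1/10 (⟦⟧-mono d·n≤10len) ⟩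
    1/10 * ⟦ 10 ℕ.* len ⟧        ≡⟨ cong (1/10 *_) (⟦⟧-* 10 len) ⟩
    1/10 * (⟦ 10 ⟧ * ⟦ len ⟧)    ≡⟨ cancel ⟦ len ⟧ ⟩
    ⟦ len ⟧                      ∎
    where
    open ≤-Reasoning
    open +-*-Solver using (solve; _:*_; _:=_; con)
    n²-nonNeg : NonNegative (⟦ n ⟧ * ⟦ n ⟧)
    n²-nonNeg = nonNeg*nonNeg⇒nonNeg ⟦ n ⟧ {{⟦⟧-nonNeg n}} ⟦ n ⟧ {{⟦⟧-nonNeg n}}
    regroup : ∀ a b → (a * 1/10) * (b * b) ≡ 1/10 * ((a * b) * b)
    regroup = solve 2 (λ a b → (a :* con 1/10) :* (b :* b) := con 1/10 :* ((a :* b) :* b)) refl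
    cancel : ∀ a → 1/10 * (⟦ 10 ⟧ * a) ≡ a
    cancel = solve 1 (λ a → con 1/10 :* (con ⟦ 10 ⟧ :* a) := a) refl

  *-positive : ∀ {r} s .{{_ : ℚ.Positive s}} → 0ℚ < r → 0ℚ < r * s
  *-positive {r} s r>0 = positive⁻¹ (r * s) {{pos*pos⇒pos r {{ℚ.positive r>0}} s}}

  eventually-≥9 : ∀ (ν : ℚ) → 0ℚ < ν → ∃[ n₀ ] ∀ n → n₀ ℕ.≤ n → ⟦ 9 ⟧ ≤ ν * ⟦ n ⟧
  eventually-≥9 ν ν>0 = k , λ n k≤n → begin
      ⟦ 9 ⟧                ≡⟨ unscale ⟨
      (⟦ 9 ⟧ * 1/ ν) * ν   ≤⟨ *-monoʳ-≤-nonNeg ν {{pos⇒nonNeg ν}} (proj₂ (⟦⟧-unbounded (⟦ 9 ⟧ * 1/ ν))) ⟩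
      ⟦ k ⟧ * ν            ≤⟨ *-monoʳ-≤-nonNeg ν {{pos⇒nonNeg ν}} (⟦⟧-mono k≤n) ⟩
      ⟦ n ⟧ * ν            ≡⟨ *-comm ⟦ n ⟧ ν ⟩
      ν * ⟦ n ⟧            ∎
    where
    open ≤-Reasoning
    instance
      ν-positive : ℚ.Positive ν
      ν-positive = ℚ.positive ν>0
      ν-nonZero : ℚ.NonZero ν
      ν-nonZero = pos⇒nonZero ν
    k = proj₁ (⟦⟧-unbounded (⟦ 9 ⟧ * 1/ ν))
    unscale : (⟦ 9 ⟧ * 1/ ν) * ν ≡ ⟦ 9 ⟧
    unscale = trans (*-assoc ⟦ 9 ⟧ (1/ ν) ν)
                    (trans (cong (⟦ 9 ⟧ *_) (*-inverseˡ ν)) (*-identityʳ ⟦ 9 ⟧))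

-- The counting around a fixed edge e = xπ(x) of a directed Hamilton cycle.  The
-- cycle is numbered c₀ = π(x), …, c_{n-1} = x; a chord π⁻¹(u)π(v) with u not
-- after v (both away from e) is a non-cycle edge whose path from π(v) to π⁻¹(u)
-- passes x.
module AroundEdge {n : ℕ.ℕ} (G : Graph n) (π : Fin n → Fin n) (H : DirHamCycle G π)
                  (x : Fin n) (n>0 : 0 ℕ.< n) where

  open import Data.Nat using (ℕ; zero; suc; _+_; _*_; _∸_; _≤_; _<_; z≤n; s≤s; _<ᵇ_)
  open import Data.Nat.Properties hiding (_≟_)
  open import Data.Nat.Tactic.RingSolver using (solve-∀)
  open import Data.Bool using (Bool; true; false; T; not; _∧_; _∨_)
  open import Data.Bool.Properties using (T-∧; T-∨; ∧-comm)
  open import Data.Product using (_×_; _,_; proj₁; proj₂)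
  open import Data.Sum using (_⊎_; inj₁; inj₂)
  open import Data.Empty using (⊥-elim)
  open import Data.Unit using (tt)
  open import Data.List using (List; length)
  open import Data.List.Relation.Unary.All as All using (All)
  open import Data.List.Relation.Unary.Unique.Propositional using (Unique)
  open import Function using (_∘_)
  open import Function.Bundles using (module Equivalence)
  open import Relation.Binary.PropositionalEquality
  open import Relation.Nullary using (¬_)
  open Equivalence using (to; from)
  open Counting
  open Pairing
  open Estimates
  open Switchings
  open DirHamCycle H
  open CyclePositions using (iter-+)
  open CyclePositions.Numbering π π-inj π-trans (π x) n>0

  c-last : c (n ∸ 1) ≡ x
  c-last = π-inj (trans (cong c (m+[n∸m]≡n {1} {n} n>0)) period)

  is-at : ∀ v {k} → pos v ≡ k → T (v ≡ᵇ c k)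
  is-at v refl = subst (λ w → T (w ≡ᵇ c (pos v))) (c-pos v) (≡ᵇ-refl (c (pos v)))

  -- The vertices π(x), π⁻¹(x), x at positions 0, n-2, n-1.
  near : Fin n → Bool
  near v = (v ≡ᵇ c 0) ∨ ((v ≡ᵇ c (n ∸ 2)) ∨ (v ≡ᵇ c (n ∸ 1)))

  count-near : count near ≤ 3
  count-near =
    ≤-trans (count-∨ (_≡ᵇ c 0) (λ v → (v ≡ᵇ c (n ∸ 2)) ∨ (v ≡ᵇ c (n ∸ 1))))
      (+-mono-≤ (count-singleton (c 0))
        (≤-trans (count-∨ (_≡ᵇ c (n ∸ 2)) (_≡ᵇ c (n ∸ 1)))
          (+-mono-≤ (count-singleton (c (n ∸ 2))) (count-singleton (c (n ∸ 1))))))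

  near-at : ∀ v → pos v ≡ 0 ⊎ pos v ≡ n ∸ 2 ⊎ pos v ≡ n ∸ 1 → T (near v)
  near-at v (inj₁ e)        = from (T-∨ {v ≡ᵇ c 0}) (inj₁ (is-at v e))
  near-at v (inj₂ (inj₁ e)) = from (T-∨ {v ≡ᵇ c 0}) (inj₂ (from (T-∨ {v ≡ᵇ c (n ∸ 2)}) (inj₁ (is-at v e))))
  near-at v (inj₂ (inj₂ e)) = from (T-∨ {v ≡ᵇ c 0}) (inj₂ (from (T-∨ {v ≡ᵇ c (n ∸ 2)}) (inj₂ (is-at v e))))

  far-position : ∀ v → ¬ T (near v) → 1 ≤ pos v × pos v + 3 ≤ n
  far-position v v-far = not-at-0 , subst (_≤ n) (+-comm 3 (pos v)) below-n-2
    where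
    not-at-0 : 1 ≤ pos v
    not-at-0 with pos v in e
    ... | zero  = ⊥-elim (v-far (near-at v (inj₁ e)))
    ... | suc _ = s≤s z≤n
    not-last : ∀ {i} → i < n → i ≢ n ∸ 1 → suc i < n
    not-last i<n i≢ with m≤n⇒m<n∨m≡n i<n
    ... | inj₁ lt   = lt
    ... | inj₂ refl = ⊥-elim (i≢ refl)
    below-n-2 : suc (suc (pos v)) < n
    below-n-2 = not-last (not-last (pos<n v) (λ e → v-far (near-at v (inj₂ (inj₂ e)))))
      (λ e → v-far (near-at v (inj₂ (inj₁ (trans (cong (_∸ 1) e) (∸-+-assoc n 1 1))))))

  count-∘π : (P : Fin n → Bool) → count (λ v → P (π v)) ≡ count P
  count-∘π P = ≤-antisym (count-inj π π-inj P) (begin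
    count P                         ≡⟨ count-cong P (λ v → P (π (pred v))) (λ v → cong P (sym (π-pred v))) ⟩
    count (λ v → P (π (pred v)))    ≤⟨ count-inj pred pred-inj (λ v → P (π v)) ⟩
    count (λ v → P (π v))           ∎)
    where open ≤-Reasoning

  count-∘pred : (P : Fin n → Bool) → count (λ v → P (pred v)) ≡ count P
  count-∘pred P = ≤-antisym (count-inj pred pred-inj P) (begin
    count P                         ≡⟨ count-cong P (λ v → P (pred (π v))) (λ v → cong P (sym (pred-π v))) ⟩
    count (λ v → P (pred (π v)))    ≤⟨ count-inj π π-inj (λ v → P (pred v)) ⟩
    count (λ v → P (pred v))        ∎)
    where open ≤-Reasoning

  chord-c : ∀ k l → k < l → l + 3 ≤ n →
            ¬ EdgeH π (c k) (c (suc l)) × OnPath π x (c (suc l)) (c k)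
  chord-c k l k<l l+3≤n = not-cycle-edge , (j , i , j<n , s≤s (≤-trans (m≤m+n r k) (n≤1+n _)) , to-c-k , to-x)
    where
    r = proj₁ (m≤n⇒∃[o]m+o≡n l+3≤n)
    n≡ : n ≡ 3 + (l + r)
    n≡ = trans (sym (proj₂ (m≤n⇒∃[o]m+o≡n l+3≤n))) (shift-3 l r)
      where
      shift-3 : ∀ l r → l + 3 + r ≡ 3 + (l + r)
      shift-3 = solve-∀
    l+2<n : suc (suc l) < n
    l+2<n = subst (suc (suc l) <_) (sym n≡) (s≤s (s≤s (s≤s (m≤m+n l r))))
    not-cycle-edge : ¬ EdgeH π (c k) (c (suc l))
    not-cycle-edge (inj₁ e) = <⇒≢ (s≤s k<l)
      (sym (c-inj (<-trans (n<1+n _) l+2<n) (<-trans (s≤s k<l) (<-trans (n<1+n _) l+2<n)) e))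
    not-cycle-edge (inj₂ e) = <⇒≢ (<-trans k<l (<-trans (n<1+n _) (n<1+n _)))
      (c-inj (<-trans (<-trans k<l (<-trans (n<1+n _) (n<1+n _))) l+2<n) l+2<n e)
    j = 2 + (r + k)
    i = suc r
    j<n : j < n
    j<n = subst (j <_) (sym n≡)
      (s≤s (s≤s (s≤s (≤-trans (+-monoʳ-≤ r (<⇒≤ k<l)) (≤-reflexive (+-comm r l))))))
    to-c-k : iter π j (c (suc l)) ≡ c k
    to-c-k = trans (sym (iter-+ π j (suc l) (π x)))
      (trans (cong c (trans (around k l r) (cong (k +_) (sym n≡)))) (c-+n k))
      where
      around : ∀ k l r → 2 + (r + k) + suc l ≡ k + (3 + (l + r))
      around = solve-∀
    to-x : iter π i (c (suc l)) ≡ x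
    to-x = trans (sym (iter-+ π i (suc l) (π x)))
      (trans (cong c (trans (before-x l r) (cong (_∸ 1) (sym n≡)))) c-last)
      where
      before-x : ∀ l r → suc r + suc l ≡ 2 + (l + r)
      before-x = solve-∀

  chord : ∀ {u v} → 1 ≤ pos u → pos u ≤ pos v → pos v + 3 ≤ n →
          ¬ EdgeH π (pred u) (π v) × OnPath π x (π v) (pred u)
  chord {u} {v} u≥1 u≤v v+3≤n =
    subst₂ (λ x′ y′ → ¬ EdgeH π x′ y′ × OnPath π x y′ x′) c-k≡pred-u (cong π (c-pos v))
           (chord-c k (pos v) (subst (_≤ pos v) pos-u≡ u≤v) v+3≤n)
    where
    k = pos u ∸ 1
    pos-u≡ : pos u ≡ suc k
    pos-u≡ = sym (m+[n∸m]≡n {1} u≥1)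
    c-k≡pred-u : c k ≡ pred u
    c-k≡pred-u = trans (sym (pred-c k)) (cong pred (trans (cong c (sym pos-u≡)) (c-pos u)))

  ordered-switch : ∀ τ {u v} → ¬ T (near u) → ¬ T (near v) → pos u ≤ pos v →
                   E G (pred u) (π v) → AddedEdges G π τ x u v →
                   GoodSwitch G π x (pred u , π v , τ)
  ordered-switch τ {u} {v} u-far v-far u≤v chord-edge added =
    chord-edge , proj₁ geometry , proj₂ geometry ,
    admissible G π π-edge τ x (pred u) (π v) v chord-edge (λ _ e → π-inj e)
               (subst (λ w → AddedEdges G π τ x w v) (sym (π-pred u)) added)
    where
    geometry = chord (proj₁ (far-position u u-far)) u≤v (proj₂ (far-position v v-far))

  module Bipartition (inA : Fin n → Bool)
                     (A-independent : ∀ u v → T (inA u) → T (inA v) → ¬ E G u v) where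

    inB : Fin n → Bool
    inB = InB inA

    π-from-A : ∀ v → T (inA v) → T (inB (π v))
    π-from-A v v∈A = T-not-intro (λ πv∈A → A-independent v (π v) v∈A πv∈A (π-edge v))

    pred-from-A : ∀ v → T (inA v) → T (inB (pred v))
    pred-from-A v v∈A = T-not-intro (λ pv∈A →
      A-independent (pred v) v pv∈A v∈A (subst (E G (pred v)) (π-pred v) (π-edge (pred v))))

    surplus : ℕ
    surplus = count (λ v → inB v ∧ inB (pred v))

    |A|+|B|≡n : count inA + count inB ≡ n
    |A|+|B|≡n = trans (sym (count-split (λ _ → true) inA)) (count-all n)
      where
      count-all : ∀ k → count {k} (λ _ → true) ≡ k
      count-all zero    = refl
      count-all (suc k) = cong suc (count-all k)

    |B|≡|A|+surplus : count inB ≡ count inA + surplus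
    |B|≡|A|+surplus = begin
      count inB                                     ≡⟨ count-split inB (λ v → inA (pred v)) ⟩
      count (λ v → inB v ∧ inA (pred v)) + surplus  ≡⟨ cong (_+ surplus) after-A ⟩
      count inA + surplus                           ∎
      where
      open ≡-Reasoning
      -- a vertex whose predecessor is in A lies in B, and v ↦ π⁻¹(v) is a bijection
      after-A : count (λ v → inB v ∧ inA (pred v)) ≡ count inA
      after-A = trans (≤-antisym (count-mono B∧A∘pred A∘pred (λ v t → proj₂ (to T-∧ t)))
                                 (count-mono A∘pred B∧A∘pred (λ v pv∈A → T-∧-intro
                                   (subst (λ w → T (inB w)) (π-pred v) (π-from-A (pred v) pv∈A)) pv∈A)))
                      (count-∘pred inA)
        where
        A∘pred B∧A∘pred : Fin n → Bool
        A∘pred v = inA (pred v)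
        B∧A∘pred v = inB v ∧ inA (pred v)

    surplus-π : count (λ v → inB v ∧ inB (π v)) ≡ surplus
    surplus-π = begin
      count (λ v → inB v ∧ inB (π v))              ≡⟨ count-cong _ _ (λ v → cong (λ w → inB w ∧ inB (π v)) (sym (pred-π v))) ⟩
      count (λ v → inB (pred (π v)) ∧ inB (π v))   ≡⟨ count-∘π (λ w → inB (pred w) ∧ inB w) ⟩
      count (λ w → inB (pred w) ∧ inB w)           ≡⟨ count-cong _ _ (λ w → ∧-comm (inB (pred w)) (inB w)) ⟩
      surplus                                      ∎
      where open ≡-Reasoning

    surplus≡|B|-|A| : surplus ≡ count inB ∸ count inA
    surplus≡|B|-|A| = trans (sym (m+n∸m≡n (count inA) surplus))
                            (cong (_∸ count inA) (sym |B|≡|A|+surplus))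

    -- Pivots and partners for the endpoints a ∈ A and b ∈ B of e, relative to a
    -- set X of atypical A-vertices.
    module Candidates (X : Fin n → Bool) (a b : Fin n) where

      typical : Fin n → Bool
      typical v = inA v ∧ not (X v)

      pivot : Fin n → Bool
      pivot p = adj G a p ∧ (typical (pred p) ∧ (typical (π p) ∧ not (near p)))

      partner : Fin n → Fin n → Bool
      partner p q = inA q ∧ (adj G b q ∧ (adj G (pred p) (π q) ∧ (adj G (π p) (pred q) ∧ not (near q))))

      typical-elim : ∀ {v} → T (typical v) → T (inA v) × ¬ T (X v)
      typical-elim t = proj₁ (to T-∧ t) , T-not-elim (proj₂ (to T-∧ t))

      pivot-elim : ∀ {p} → T (pivot p) →
                   E G a p × T (typical (pred p)) × T (typical (π p)) × ¬ T (near p)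
      pivot-elim t =
        let (a~p , t₁) = to T-∧ t; (tp , t₂) = to T-∧ t₁; (tπ , t₃) = to T-∧ t₂
        in a~p , tp , tπ , T-not-elim t₃

      partner-elim : ∀ {p q} → T (partner p q) →
        E G b q × E G (pred p) (π q) × E G (π p) (pred q) × ¬ T (near q)
      partner-elim {p} {q} t =
        let (_ , t₁) = to (T-∧ {inA q}) t; (b~q , t₂) = to T-∧ t₁; (e₁ , t₃) = to T-∧ t₂; (e₂ , t₄) = to T-∧ t₃
        in b~q , e₁ , e₂ , T-not-elim t₄

      -- Why a B-neighbour of a can fail to be a pivot.
      pivot-or-defect : ∀ ib ad ap xp aπ xπ nr → T (ib ∧ ad) →
        T ((ad ∧ ((ap ∧ not xp) ∧ ((aπ ∧ not xπ) ∧ not nr)))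
           ∨ ((ib ∧ not ap) ∨ (xp ∨ ((ib ∧ not aπ) ∨ (xπ ∨ nr)))))
      pivot-or-defect true true false _     _     _     _     _ = tt
      pivot-or-defect true true true  true  _     _     _     _ = tt
      pivot-or-defect true true true  false false _     _     _ = tt
      pivot-or-defect true true true  false true  true  _     _ = tt
      pivot-or-defect true true true  false true  false true  _ = tt
      pivot-or-defect true true true  false true  false false _ = tt

      pivots-cover : deg G a inB ≤
        count pivot + (surplus + (count X + (surplus + (count X + count near))))
      pivots-cover = begin
        deg G a inB                        ≤⟨ count-mono _ (λ v → pivot v ∨ defect₁ v) classify ⟩
        count (λ v → pivot v ∨ defect₁ v)  ≤⟨ count-∨ pivot defect₁ ⟩
        count pivot + count defect₁        ≤⟨ +-monoʳ-≤ (count pivot) defects ⟩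
        count pivot + (surplus + (count X + (surplus + (count X + count near)))) ∎
        where
        open ≤-Reasoning
        B∘pred X∘pred B∘π X∘π defect₁ defect₂ defect₃ defect₄ : Fin n → Bool
        B∘pred v = inB v ∧ inB (pred v)
        X∘pred v = X (pred v)
        B∘π v = inB v ∧ inB (π v)
        X∘π v = X (π v)
        defect₄ v = X∘π v ∨ near v
        defect₃ v = B∘π v ∨ defect₄ v
        defect₂ v = X∘pred v ∨ defect₃ v
        defect₁ v = B∘pred v ∨ defect₂ v
        classify : ∀ v → T (inB v ∧ adj G a v) → T (pivot v ∨ defect₁ v)
        classify v = pivot-or-defect (inB v) (adj G a v) (inA (pred v)) (X (pred v))
                                     (inA (π v)) (X (π v)) (near v)
        defects : count defect₁ ≤ surplus + (count X + (surplus + (count X + count near)))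
        defects =
          ≤-trans (count-∨ B∘pred defect₂) (+-monoʳ-≤ surplus
          (≤-trans (count-∨ X∘pred defect₃) (+-mono-≤ (≤-reflexive (count-∘pred X))
          (≤-trans (count-∨ B∘π defect₄) (+-mono-≤ (≤-reflexive surplus-π)
          (≤-trans (count-∨ X∘π near) (+-monoˡ-≤ (count near) (≤-reflexive (count-∘π X)))))))))

      -- Why an A-neighbour q of b can fail to be a partner of p (using that π(q),
      -- π⁻¹(q) ∈ B).
      partner-or-miss : ∀ ia ab e₁ e₂ nr b₁ b₂ → T (ia ∧ ab) → T b₁ → T b₂ →
        T ((ia ∧ (ab ∧ (e₁ ∧ (e₂ ∧ not nr)))) ∨ ((b₁ ∧ not e₁) ∨ ((b₂ ∧ not e₂) ∨ nr)))
      partner-or-miss true true false _     _     true true _ _ _ = tt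
      partner-or-miss true true true  false _     true true _ _ _ = tt
      partner-or-miss true true true  true  true  true true _ _ _ = tt
      partner-or-miss true true true  true  false true true _ _ _ = tt

      missed : Fin n → Fin n → Bool
      missed v w = inB w ∧ not (adj G v w)

      partners-cover : ∀ p → deg G b inA ≤
        count (partner p) + (count (missed (pred p)) + (count (missed (π p)) + count near))
      partners-cover p = begin
        deg G b inA                          ≤⟨ count-mono _ (λ q → partner p q ∨ miss₁ q) classify ⟩
        count (λ q → partner p q ∨ miss₁ q)  ≤⟨ count-∨ (partner p) miss₁ ⟩
        count (partner p) + count miss₁      ≤⟨ +-monoʳ-≤ (count (partner p)) misses ⟩
        count (partner p) + (count (missed (pred p)) + (count (missed (π p)) + count near)) ∎
        where
        open ≤-Reasoning
        missed∘π missed∘pred miss₁ miss₂ : Fin n → Bool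
        missed∘π q = missed (pred p) (π q)
        missed∘pred q = missed (π p) (pred q)
        miss₂ q = missed∘pred q ∨ near q
        miss₁ q = missed∘π q ∨ miss₂ q
        classify : ∀ q → T (inA q ∧ adj G b q) → T (partner p q ∨ miss₁ q)
        classify q t = partner-or-miss (inA q) (adj G b q) (adj G (pred p) (π q)) (adj G (π p) (pred q))
                         (near q) (inB (π q)) (inB (pred q)) t
                         (π-from-A q (proj₁ (to T-∧ t))) (pred-from-A q (proj₁ (to T-∧ t)))
        misses : count miss₁ ≤ count (missed (pred p)) + (count (missed (π p)) + count near)
        misses =
          ≤-trans (count-∨ missed∘π miss₂) (+-mono-≤ (≤-reflexive (count-∘π (missed (pred p))))
          (≤-trans (count-∨ missed∘pred near) (+-monoˡ-≤ (count near) (≤-reflexive (count-∘pred (missed (π p)))))))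

      module Sizes
        (typical-degree : ∀ v → T (typical v) → 49 * n ≤ 100 * deg G v inB)
        (b-degree       : 24 * n ≤ 100 * deg G b inA)
        (surplus-small  : 100 * surplus ≤ deg G a inB)
        (X-small        : 100 * count X ≤ deg G a inB)
        (a-degree       : 9 ≤ deg G a inB)
        (n≥300          : 300 ≤ n) where

        -- 2|B| = n + surplus ≤ n + n/100.
        |B|-bound : 200 * count inB ≤ 101 * n
        |B|-bound = begin
          200 * count inB                     ≡⟨ double (count inB) ⟩
          100 * (count inB + count inB)       ≡⟨ cong (λ k → 100 * (k + count inB)) |B|≡|A|+surplus ⟩
          100 * (count inA + surplus + count inB) ≡⟨ cong (100 *_) (swap (count inA) surplus (count inB)) ⟩
          100 * (count inA + count inB + surplus) ≡⟨ cong (λ k → 100 * (k + surplus)) |A|+|B|≡n ⟩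
          100 * (n + surplus)                 ≡⟨ *-distribˡ-+ 100 n surplus ⟩
          100 * n + 100 * surplus             ≤⟨ +-monoʳ-≤ (100 * n) (≤-trans surplus-small (count-≤ _)) ⟩
          100 * n + n                         ≡⟨ collect n ⟩
          101 * n                             ∎
          where
          open ≤-Reasoning
          double : ∀ k → 200 * k ≡ 100 * (k + k)
          double = solve-∀
          swap : ∀ i j k → i + j + k ≡ i + k + j
          swap = solve-∀
          collect : ∀ k → 100 * k + k ≡ 101 * k
          collect = solve-∀

        many-partners : ∀ p → T (pivot p) → n ≤ 5 * count (partner p)
        many-partners p is-pivot =
          partners-estimate n (deg G b inA) (deg G (pred p) inB) (deg G (π p) inB)
            (count (partner p)) (count (missed (pred p))) (count (missed (π p))) (count near)
            (count inB) (partners-cover p) count-near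
            (count-split inB (adj G (pred p))) (count-split inB (adj G (π p)))
            (typical-degree (pred p) pred-typical) (typical-degree (π p) π-typical)
            b-degree |B|-bound n≥300
          where
          pred-typical = proj₁ (proj₂ (pivot-elim is-pivot))
          π-typical    = proj₁ (proj₂ (proj₂ (pivot-elim is-pivot)))

        many-pivots : deg G a inB ≤ 2 * count pivot
        many-pivots = pivots-estimate (deg G a inB) (count pivot) surplus (count X) (count near)
                        pivots-cover count-near surplus-small X-small a-degree

      -- The switching of a pivot p and a partner q: the chord joins π⁻¹ of the
      -- earlier of p, q to π of the later one, and the switching type (τ or τ′)
      -- records which of the two came first.
      module Switches (τ τ′ : SwitchType) (τ≢τ′ : τ ≢ τ′)
        (closes  : ∀ p q → E G a p → E G b q → AddedEdges G π τ  x p q)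
        (closes′ : ∀ p q → E G a p → E G b q → AddedEdges G π τ′ x q p) where

        Triple : Set
        Triple = Fin n × Fin n × SwitchType

        switch-by : Bool → Fin n → Fin n → Triple
        switch-by true  p q = pred p , π q , τ
        switch-by false p q = pred q , π p , τ′

        switch : Fin n → Fin n → Triple
        switch p q = switch-by (pos p <ᵇ pos q) p q

        switch-good : ∀ p q → T (pivot p) → T (partner p q) → GoodSwitch G π x (switch p q)
        switch-good p q is-pivot is-partner
          with pivot-elim is-pivot | partner-elim is-partner | pos p <ᵇ pos q in order
        ... | a~p , _ , _ , p-far | b~q , chord-edge , _ , q-far | true  =
          ordered-switch τ p-far q-far (<⇒≤ (<ᵇ⇒< (pos p) (pos q) (subst T (sym order) tt)))
                         chord-edge (closes p q a~p b~q)
        ... | a~p , _ , _ , p-far | b~q , _ , back-edge , q-far | false =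
          ordered-switch τ′ q-far p-far (≮⇒≥ (λ p<q → subst T order (<⇒<ᵇ p<q)))
                         (E-sym G back-edge) (closes′ p q a~p b~q)

        switch-by-pivot : ∀ β β′ p q p′ q′ → switch-by β p q ≡ switch-by β′ p′ q′ → p ≡ p′
        switch-by-pivot true  true  _ _ _ _ e = pred-inj (cong proj₁ e)
        switch-by-pivot false false _ _ _ _ e = π-inj (cong (proj₁ ∘ proj₂) e)
        switch-by-pivot true  false _ _ _ _ e = ⊥-elim (τ≢τ′ (cong (proj₂ ∘ proj₂) e))
        switch-by-pivot false true  _ _ _ _ e = ⊥-elim (τ≢τ′ (sym (cong (proj₂ ∘ proj₂) e)))

        switch-by-partner : ∀ β β′ p q q′ → switch-by β p q ≡ switch-by β′ p q′ → q ≡ q′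
        switch-by-partner true  true  _ _ _ e = π-inj (cong (proj₁ ∘ proj₂) e)
        switch-by-partner false false _ _ _ e = pred-inj (cong proj₁ e)
        switch-by-partner true  false _ _ _ e = ⊥-elim (τ≢τ′ (cong (proj₂ ∘ proj₂) e))
        switch-by-partner false true  _ _ _ e = ⊥-elim (τ≢τ′ (sym (cong (proj₂ ∘ proj₂) e)))

        switches : List Triple
        switches = pairs switch (λ p → elems (partner p)) (elems pivot)

        switches-unique : Unique switches
        switches-unique = pairs-unique switch _
          (λ {p} {q} {p′} {q′} → switch-by-pivot _ _ p q p′ q′)
          (λ {p} {q} {q′} → switch-by-partner _ _ p q q′)
          (λ p → elems-unique (partner p)) (elems pivot) (elems-unique pivot)

        switches-good : All (GoodSwitch G π x) switches
        switches-good = pairs-all switch _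
          (λ p is-pivot → All.tabulate (λ {q} q∈ →
             switch-good p q is-pivot (All.lookup (elems-all (partner p)) q∈)))
          (elems pivot) (elems-all pivot)

        switches-many : (∀ p → T (pivot p) → n ≤ 5 * count (partner p)) →
                        deg G a inB ≤ 2 * count pivot → deg G a inB * n ≤ 10 * length switches
        switches-many many-partners many-pivots = begin
          deg G a inB * n                   ≤⟨ *-monoˡ-≤ n many-pivots ⟩
          2 * count pivot * n               ≡⟨ *-assoc 2 (count pivot) n ⟩
          2 * (count pivot * n)             ≡⟨ cong (λ k → 2 * (k * n)) (elems-length pivot) ⟨
          2 * (length (elems pivot) * n)    ≡⟨ cong (2 *_) (*-comm (length (elems pivot)) n) ⟩
          2 * (n * length (elems pivot))    ≤⟨ *-monoʳ-≤ 2 (pairs-length switch _ n 5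
                                                (λ p is-pivot → subst (λ k → n ≤ 5 * k) (sym (elems-length (partner p)))
                                                                      (many-partners p is-pivot))
                                                (elems pivot) (elems-all pivot)) ⟩
          2 * (5 * length switches)         ≡⟨ *-assoc 2 5 (length switches) ⟨
          10 * length switches              ∎
          where open ≤-Reasoning

open import Data.Nat using (ℕ; _≥_)
import Data.Nat.Properties as ℕP
open import Data.Rational using (ℚ; _<_; _≤_; _*_; 0ℚ; ½; _-_)
import Data.Rational as ℚ
import Data.Rational.Properties as ℚP
open import Data.Bool using (Bool; T)
open import Data.Product using (Σ; _×_; _,_; proj₁; proj₂)
open import Data.Sum using (_⊎_; inj₁; inj₂; [_,_]′)
open import Data.Empty using (⊥-elim)
open import Data.List using (List; length)
open import Data.List.Relation.Unary.All using (All)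
open import Data.List.Relation.Unary.Unique.Propositional using (Unique)
open import Relation.Binary.PropositionalEquality using (_≢_; subst; sym)
open import Relation.Nullary using (¬_; yes; no)
open import Relation.Nullary.Decidable using (T?)
open Counting using (T-not-intro)
open Switchings using (E-sym; AddedEdges)
open Rationals

SwitchFamily : ∀ {n} → Graph n → (Fin n → Fin n) → Fin n → ℚ → Set
SwitchFamily {n} G π x β = Σ (List (Fin n × Fin n × SwitchType)) λ L →
  Unique L × All (GoodSwitch G π x) L × (β * (⟦ n ⟧ * ⟦ n ⟧) ≤ ⟦ length L ⟧)

-- The main counting statement for a fixed orientation: a ∈ A and b ∈ B are the
-- endpoints of e = xπ(x), and τ, τ′ are the switching types that close a chord
-- π⁻¹(p)π(q), respectively π⁻¹(q)π(p), using the edges ap and bq.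
many-switchings : ∀ {n} {η ν β α : ℚ} → η ≤ η₀ → β ≤ ν * 1/10 → α ≤ ν * 1/100 →
  300 ℕ.≤ n → ⟦ 9 ⟧ ≤ ν * ⟦ n ⟧ →
  (G : Graph n) (inA : Fin n → Bool) → Superextremal α η ν G inA →
  (∀ u v → T (inA u) → T (inA v) → ¬ E G u v) →
  (π : Fin n → Fin n) → DirHamCycle G π → (x a b : Fin n) →
  T (inA a) → T (InB inA b) → (τ τ′ : SwitchType) → τ ≢ τ′ →
  (∀ p q → E G a p → E G b q → AddedEdges G π τ  x p q) →
  (∀ p q → E G a p → E G b q → AddedEdges G π τ′ x q p) →
  SwitchFamily G π x β
many-switchings {n} {η} {ν} {β} {α} η≤η₀ β≤ α≤ n≥300 νn≥9 G inA SE A-independent π H x a b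
                a∈A b∈B τ τ′ τ≢τ′ closes closes′ =
  switches , switches-unique , switches-good ,
  quadratic-count β ν n (deg G a inB) (length switches) β≤ νn≤deg-a
                  (switches-many many-partners many-pivots)
  where
  open Superextremal SE
  n>0 = ℕP.≤-trans (ℕ.s≤s ℕ.z≤n) n≥300
  open AroundEdge G π H x n>0
  open Bipartition inA A-independent
  X = proj₁ B2
  open Candidates X a b
  νn≤deg-a : ν * ⟦ n ⟧ ≤ ⟦ deg G a inB ⟧
  νn≤deg-a = B3 a a∈A
  typical-degree : ∀ v → T (typical v) → 49 ℕ.* n ℕ.≤ 100 ℕ.* deg G v inB
  typical-degree v t = half-degree η n (deg G v inB) η≤η₀
    (proj₂ (proj₂ B2) v (proj₁ (typical-elim t)) (proj₂ (typical-elim t)))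
  surplus-small : 100 ℕ.* surplus ℕ.≤ deg G a inB
  surplus-small = subst (λ k → 100 ℕ.* k ℕ.≤ deg G a inB) (sym surplus≡|B|-|A|)
                        (tiny-vs-degree α ν (count inB ℕ.∸ count inA) n (deg G a inB) α≤ νn≤deg-a B1b)
  open Sizes typical-degree (quarter-degree η n (deg G b inA) η≤η₀ (B5 b b∈B)) surplus-small
             (tiny-vs-degree α ν (count X) n (deg G a inB) α≤ νn≤deg-a (proj₁ (proj₂ B2)))
             (⟦⟧-reflects-≤ (ℚP.≤-trans νn≥9 νn≤deg-a)) n≥300
  open Switches τ τ′ τ≢τ′ closes closes′

endpoints : ∀ {n} (G : Graph n) (inA : Fin n → Bool) (M : Fin n → Fin n → Bool) →
  (∀ u v → T (inA u) → T (inA v) → ¬ E G u v) →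
  (∀ u v → T (InB inA u) → T (InB inA v) → E G u v → T (M u v)) →
  ∀ u v → E G u v → ¬ T (M u v) → (T (inA u) × T (InB inA v)) ⊎ (T (inA v) × T (InB inA u))
endpoints G inA M A-independent B-edges-in-M u v uv e∉M with T? (inA u) | T? (inA v)
... | yes u∈A | _       = inj₁ (u∈A , T-not-intro (λ v∈A → A-independent u v u∈A v∈A uv))
... | no  u∉A | yes v∈A = inj₂ (v∈A , T-not-intro u∉A)
... | no  u∉A | no  v∉A = ⊥-elim (e∉M (B-edges-in-M u v (T-not-intro u∉A) (T-not-intro v∉A) uv))

-- Constants: η₀ = 1/100, ν₀ = 1, β₀ = ν/10, α₀ = ν/100, μ₀ = 1,
-- and n₀ = 300 + (a bound beyond which νn ≥ 9).
theorem26 :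
    Σ ℚ λ η₀ → 0ℚ < η₀ × ((η : ℚ) → 0ℚ < η → η ≤ η₀ →
    Σ ℚ λ ν₀ → 0ℚ < ν₀ × ((ν : ℚ) → 0ℚ < ν → ν ≤ ν₀ →
    Σ ℚ λ β₀ → 0ℚ < β₀ × ((β : ℚ) → 0ℚ < β → β ≤ β₀ →
    Σ ℚ λ α₀ → 0ℚ < α₀ × ((α : ℚ) → 0ℚ < α → α ≤ α₀ →
    Σ ℚ λ μ₀ → 0ℚ < μ₀ × ((μ : ℚ) → 0ℚ < μ → μ ≤ μ₀ →
    Σ ℕ λ n₀ → (n : ℕ) → n ≥ n₀ →
      (G : Graph n) (inA : Fin n → Bool) →
      Superextremal α η ν G inA →
      (M : Fin n → Fin n → Bool) →
      MatchingIn G (InB inA) M →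
      ⟦ edgeCount M ⟧ ≤ α * ⟦ n ⟧ →
      -- (D1)
      (∀ u v → T (inA u) → T (inA v) → ¬ E G u v) →
      (∀ u v → T (InB inA u) → T (InB inA v) → E G u v → T (M u v)) →
      -- (D2)
      (∀ a b → T (inA a) → T (InB inA b) → E G a b →
        ((½ - η) * ⟦ n ⟧ ≤ ⟦ deg G a (InB inA) ⟧)
        ⊎ ((½ - η) * ⟦ n ⟧ ≤ ⟦ deg G b inA ⟧)) →
      (π : Fin n → Fin n) → DirHamCycle G π →
      (x : Fin n) → ¬ T (M x (π x)) →
      Σ (List (Fin n × Fin n × SwitchType)) λ L →
        Unique L × All (GoodSwitch G π x) L
        × (β * (⟦ n ⟧ * ⟦ n ⟧) ≤ ⟦ length L ⟧))))))
theorem26 =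
  η₀ , ℚP.positive⁻¹ η₀ , λ η _ η≤η₀ →
  ℚ.1ℚ , ℚP.positive⁻¹ ℚ.1ℚ , λ ν ν>0 _ →
  ν * 1/10 , *-positive 1/10 ν>0 , λ β _ β≤ →
  ν * 1/100 , *-positive 1/100 ν>0 , λ α _ α≤ →
  ℚ.1ℚ , ℚP.positive⁻¹ ℚ.1ℚ , λ _ _ _ →
  let (k , νn≥9-beyond-k) = eventually-≥9 ν ν>0 in
  k ℕ.+ 300 , λ n n≥n₀ G inA SE M _ _ A-independent B-edges-in-M _ π H x e∉M →
    let n≥300 = ℕP.≤-trans (ℕP.m≤n+m 300 k) n≥n₀
        νn≥9  = νn≥9-beyond-k n (ℕP.≤-trans (ℕP.m≤m+n k 300) n≥n₀)
        count-for = many-switchings η≤η₀ β≤ α≤ n≥300 νn≥9 G inA SE A-independent π H x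
    in [ (λ (x∈A , πx∈B) → count-for x (π x) x∈A πx∈B s₁ s₂ (λ ())
                             (λ p q a~p b~q → a~p , E-sym G b~q) (λ p q a~p b~q → a~p , b~q))
       , (λ (πx∈A , x∈B) → count-for (π x) x πx∈A x∈B s₂ s₁ (λ ())
                             (λ p q a~p b~q → b~q , a~p) (λ p q a~p b~q → b~q , E-sym G a~p))
       ]′ (endpoints G inA M A-independent B-edges-in-M x (π x) (DirHamCycle.π-edge H x) e∉M)
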